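{- For every closure model $\mathcal{M}=(X,\mathcal{C},\mathcal{V})$ and all $x_1,x_2\in X$: $x_1$ and $x_2$ satisfy exactly the same formulas of the infinitary modal logic IML if and only if $x_1$ and $x_2$ are CM-bisimilar.
   Context: A closure space is a pair $(X,\mathcal{C})$ with $X$ a non-empty set and $\mathcal{C}:\mathcal{P}(X)\to\mathcal{P}(X)$ such that $\mathcal{C}(\emptyset)=\emptyset$, $A\subseteq\mathcal{C}(A)$ and $\mathcal{C}(A_1\cup A_2)=\mathcal{C}(A_1)\cup\mathcal{C}(A_2)$. Interior: $\mathcal{I}(A)=X\setminus\mathcal{C}(X\setminus A)$; a neighbourhood of $x$ is any $S$ with $x\in\mathcal{I}(S)$. Fix a set $AP$ of atomic propositions. A closure model is $(X,\mathcal{C},\mathcal{V})$ with $\mathcal{V}:AP\to\mathcal{P}(X)$; $\mathcal{V}^{ -1}(x)=\{p: x\in\mathcal{V}(p)\}$. IML formulas: $\Phi::=p\mid\neg\Phi\mid\bigwedge_{i\in I}\Phi_i\mid\mathcal{N}\Phi$ with $p\in AP$ and $I$ an arbitrary index set. Semantics: $x\models p$ iff $x\in\mathcal{V}(p)$; negation and conjunction as usual; $x\models\mathcal{N}\Phi$ iff $x\in\mathcal{C}([\![\Phi]\!])$, where $[\![\Phi]\!]=\{y\in X: y\models\Phi\}$. A CM-bisimulation is a non-empty $B\subseteq X\times X$ such that whenever $(x_1,x_2)\in B$: (1) $\mathcal{V}^{ -1}(x_1)=\mathcal{V}^{ -1}(x_2)$; (2) for every neighbourhood $S_1$ of $x_1$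 there is a neighbourhood $S_2$ of $x_2$ such that every $s_2\in S_2$ has some $s_1\in S_1$ with $(s_1,s_2)\in B$; (3) for every neighbourhood $S_2$ of $x_2$ there is a neighbourhood $S_1$ of $x_1$ such that every $s_1\in S_1$ has some $s_2\in S_2$ with $(s_1,s_2)\in B$. $x_1,x_2$ are CM-bisimilar if some CM-bisimulation contains $(x_1,x_2)$. -}

module Defs where

open import Level using (Level; 0ℓ) renaming (suc to lsuc)
open import Data.Product using (Σ; ∃; _×_; _,_)
open import Data.Sum using (_⊎_)
open import Data.Empty using (⊥)
open import Relation.Nullary using (¬_)
open import Function.Bundles using (_⇔_)

Subset : Set → Set₁
Subset X = X → Set

module _ {X : Set} where
  ∅ : Subset X
  ∅ _ = ⊥

  ∁ : Subset X → Subset X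
  ∁ A x = ¬ A x

  _∪_ : Subset X → Subset X → Subset X
  (A ∪ B) x = A x ⊎ B x

  _⊆_ : Subset X → Subset X → Set
  A ⊆ B = ∀ x → A x → B x

  _≐_ : Subset X → Subset X → Set
  A ≐ B = (A ⊆ B) × (B ⊆ A)

-- Since subsets are predicates, we require C to respect equality of subsets
-- (in the paper subsets are extensional sets, so this is automatic there).
record ClosureSpace : Set₁ where
  field
    X          : Set
    inhabited  : X
    C          : Subset X → Subset X
    C-resp-≐   : ∀ {A B} → A ≐ B → C A ≐ C B
    C-∅        : C ∅ ≐ ∅
    C-extensive : ∀ A → A ⊆ C A
    C-∪        : ∀ A₁ A₂ → C (A₁ ∪ A₂) ≐ (C A₁ ∪ C A₂)

  I : Subset X → Subset X
  I A = ∁ (C (∁ A))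

  Nbhd : X → Subset X → Set
  Nbhd x S = I S x

record ClosureModel (AP : Set) : Set₁ where
  field
    space : ClosureSpace
  open ClosureSpace space public
  field
    V : AP → Subset X

  V⁻¹ : X → Subset AP
  V⁻¹ x p = V p x

data IML (AP : Set) : Set₁ where
  atom : AP → IML AP
  ¬'_  : IML AP → IML AP
  ⋀    : (I : Set) → (I → IML AP) → IML AP
  𝓝    : IML AP → IML AP

module _ {AP : Set} (M : ClosureModel AP) where
  open ClosureModel M

  _⊨_ : X → IML AP → Set
  x ⊨ atom p  = V p x
  x ⊨ (¬' Φ)  = ¬ (x ⊨ Φ)
  x ⊨ ⋀ I Φs  = ∀ (i : I) → x ⊨ Φs i
  x ⊨ 𝓝 Φ     = C ⟦ Φ ⟧ x
    where
    ⟦_⟧ : IML AP → Subset X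
    ⟦ Ψ ⟧ y = y ⊨ Ψ

  ⟦_⟧ : IML AP → Subset X
  ⟦ Φ ⟧ y = y ⊨ Φ

  IML-equivalent : X → X → Set₁
  IML-equivalent x₁ x₂ = ∀ (Φ : IML AP) → (x₁ ⊨ Φ) ⇔ (x₂ ⊨ Φ)

  record IsCMBisimulation (B : X → X → Set) : Set₁ where
    field
      nonempty : Σ X λ x₁ → Σ X λ x₂ → B x₁ x₂
      atoms    : ∀ {x₁ x₂} → B x₁ x₂ → V⁻¹ x₁ ≐ V⁻¹ x₂
      zig      : ∀ {x₁ x₂} → B x₁ x₂ → ∀ (S₁ : Subset X) → Nbhd x₁ S₁ →
                 Σ (Subset X) λ S₂ → Nbhd x₂ S₂ ×
                   (∀ s₂ → S₂ s₂ → Σ X λ s₁ → S₁ s₁ × B s₁ s₂)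
      zag      : ∀ {x₁ x₂} → B x₁ x₂ → ∀ (S₂ : Subset X) → Nbhd x₂ S₂ →
                 Σ (Subset X) λ S₁ → Nbhd x₁ S₁ ×
                   (∀ s₁ → S₁ s₁ → Σ X λ s₂ → S₂ s₂ × B s₁ s₂)

  CM-bisimilar : X → X → Set₁
  CM-bisimilar x₁ x₂ = Σ (X → X → Set) λ B → IsCMBisimulation B × B x₁ x₂

-- Soundness: by induction on Φ, a CM-bisimulation B preserves truth from left
-- to right; negation is handled by the converse bisimulation, and for 𝓝 Φ a
-- neighbourhood of x₂ avoiding ⟦Φ⟧ is pulled back along zag to a
-- neighbourhood of x₁ avoiding ⟦Φ⟧.
--
-- Completeness: classically, IML-equivalence itself is a CM-bisimulation.
-- For every s there is a formula that fails at s and holds at every point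
-- inequivalent to s (a disjunction of separating formulas, one per such
-- point); conjoining these over a neighbourhood S of x₁ gives a formula false
-- throughout S and true off the equivalence-image of S. Since x₁ ⊭ 𝓝 of it,
-- neither does x₂, so that image is a neighbourhood of x₂.
module Submission where

open import Defs hiding (_⊨_; ⟦_⟧)
open import Axiom.ExcludedMiddle using (ExcludedMiddle)
open import Axiom.DoubleNegationElimination using (DoubleNegationElimination; em⇒dne)
open import Function.Base using (flip; id; _∘_)
open import Function.Bundles using (_⇔_; mk⇔; Equivalence)
open import Data.Product using (Σ; _×_; _,_; proj₁; proj₂; swap)
open import Data.Sum using (inj₁; inj₂)
open import Relation.Nullary using (¬_)
open import Relation.Nullary.Decidable using (True; toWitness; fromWitness)

module ClosureSpaceProperties (𝒳 : ClosureSpace) where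
  open ClosureSpace 𝒳

  C-mono : ∀ {A B : Subset X} → A ⊆ B → C A ⊆ C B
  C-mono {A} {B} A⊆B x x∈CA =
    proj₁ (C-resp-≐ {A ∪ B} {B} (A∪B⊆B , λ _ → inj₂)) x
          (proj₂ (C-∪ A B) x (inj₁ x∈CA))
    where
    A∪B⊆B : (A ∪ B) ⊆ B
    A∪B⊆B y (inj₁ y∈A) = A⊆B y y∈A
    A∪B⊆B y (inj₂ y∈B) = y∈B

  Nbhd⇒¬C-of-disjoint : ∀ {x S} {A : Subset X} → Nbhd x S →
                         (∀ y → A y → ¬ S y) → ¬ C A x
  Nbhd⇒¬C-of-disjoint {x} nbhd A∩S≡∅ x∈CA = nbhd (C-mono A∩S≡∅ x x∈CA)

module _ {AP : Set} {M : ClosureModel AP} where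

  flip-isCMBisimulation : ∀ {B} → IsCMBisimulation M B → IsCMBisimulation M (flip B)
  flip-isCMBisimulation isB = record
    { nonempty = let (x₁ , x₂ , b) = nonempty in x₂ , x₁ , b
    ; atoms    = swap ∘ atoms
    ; zig      = zag
    ; zag      = zig
    }
    where open IsCMBisimulation isB

module Classical (lem : ∀ {ℓ} → ExcludedMiddle ℓ) where

  dne : ∀ {ℓ} → DoubleNegationElimination ℓ
  dne = em⇒dne lem

  -- IML-equivalence lives in Set₁, but a bisimulation must be Set-valued;
  -- excluded middle resizes any proposition to Set.
  Resize : ∀ {ℓ} → Set ℓ → Set
  Resize P = True (lem {P = P})

  module _ {AP : Set} (M : ClosureModel AP) where
    open ClosureModel M
    open ClosureSpaceProperties space
    open Equivalence

    _⊨_ : X → IML AP → Set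
    x ⊨ Φ = Defs._⊨_ M x Φ

    ⟦_⟧ : IML AP → Subset X
    ⟦_⟧ = Defs.⟦_⟧ M

    ¬C⇒Nbhd-∁ : ∀ {x A} → ¬ C A x → Nbhd x (∁ A)
    ¬C⇒Nbhd-∁ {x} x∉CA x∈C∁∁A = x∉CA (C-mono (λ _ → dne) x x∈C∁∁A)

    bisimulation-preserves : ∀ {B} → IsCMBisimulation M B →
                             ∀ Φ {x₁ x₂} → B x₁ x₂ → x₁ ⊨ Φ → x₂ ⊨ Φ
    bisimulation-preserves isB (atom p) b = proj₁ (IsCMBisimulation.atoms isB b) p
    bisimulation-preserves isB (¬' Φ) b x₁⊭Φ x₂⊨Φ =
      x₁⊭Φ (bisimulation-preserves (flip-isCMBisimulation isB) Φ b x₂⊨Φ)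
    bisimulation-preserves isB (⋀ I Φs) b x₁⊨Φs i =
      bisimulation-preserves isB (Φs i) b (x₁⊨Φs i)
    bisimulation-preserves isB (𝓝 Φ) {x₁} {x₂} b x₁⊨𝓝Φ = dne λ x₂⊭𝓝Φ →
      let (S₁ , S₁-nbhd , S₁-back) = IsCMBisimulation.zag isB b (∁ ⟦ Φ ⟧) (¬C⇒Nbhd-∁ x₂⊭𝓝Φ)

          ⟦Φ⟧∩S₁≡∅ : ∀ y → y ⊨ Φ → ¬ S₁ y
          ⟦Φ⟧∩S₁≡∅ y y⊨Φ y∈S₁ =
            let (s₂ , s₂⊭Φ , b′) = S₁-back y y∈S₁
            in s₂⊭Φ (bisimulation-preserves isB Φ b′ y⊨Φ)
      in Nbhd⇒¬C-of-disjoint S₁-nbhd ⟦Φ⟧∩S₁≡∅ x₁⊨𝓝Φ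

    bisimilar⇒equivalent : ∀ {x₁ x₂} → CM-bisimilar M x₁ x₂ → IML-equivalent M x₁ x₂
    bisimilar⇒equivalent (B , isB , b) Φ =
      mk⇔ (bisimulation-preserves isB Φ b)
          (bisimulation-preserves (flip-isCMBisimulation isB) Φ b)

    _≈_ : X → X → Set
    x₁ ≈ x₂ = Resize (IML-equivalent M x₁ x₂)

    ≈-refl : ∀ {x} → x ≈ x
    ≈-refl = fromWitness λ _ → mk⇔ id id

    ≈-sym : ∀ {x₁ x₂} → x₁ ≈ x₂ → x₂ ≈ x₁
    ≈-sym x₁≈x₂ = fromWitness λ Φ → let e = toWitness x₁≈x₂ Φ in mk⇔ (from e) (to e)

    separating-formula : ∀ {s t} → ¬ s ≈ t → Σ (IML AP) λ Φ → ¬ s ⊨ Φ × t ⊨ Φ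
    separating-formula s≉t = dne λ no-separator → s≉t (fromWitness λ Φ → mk⇔
      (λ s⊨Φ → dne λ t⊭Φ → no-separator (¬' Φ , (λ s⊭Φ → s⊭Φ s⊨Φ) , t⊭Φ))
      (λ t⊨Φ → dne λ s⊭Φ → no-separator (Φ , s⊭Φ , t⊨Φ)))

    ⋁ : (I : Set) → (I → IML AP) → IML AP
    ⋁ I Φs = ¬' ⋀ I (¬'_ ∘ Φs)

    apart : X → IML AP
    apart s = ⋁ (Σ X λ t → ¬ s ≈ t) (proj₁ ∘ separating-formula ∘ proj₂)

    apart-self : ∀ s → ¬ s ⊨ apart s
    apart-self s s⊨apart = s⊨apart λ (t , s≉t) → proj₁ (proj₂ (separating-formula s≉t))

    apart-≉ : ∀ {s t} → ¬ s ≈ t → t ⊨ apart s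
    apart-≉ s≉t t⊭disjuncts = t⊭disjuncts (_ , s≉t) (proj₂ (proj₂ (separating-formula s≉t)))

    avoiding : Subset X → IML AP
    avoiding S = ⋀ (Σ X S) (apart ∘ proj₁)

    avoiding-disjoint : ∀ S y → y ⊨ avoiding S → ¬ S y
    avoiding-disjoint S y y⊨avoiding y∈S = apart-self y (y⊨avoiding (y , y∈S))

    ≈-image : Subset X → Subset X
    ≈-image S t = Σ X λ s → S s × s ≈ t

    avoiding-outside-≈-image : ∀ S → ∁ (≈-image S) ⊆ ⟦ avoiding S ⟧
    avoiding-outside-≈-image S t t∉image (s , s∈S) =
      apart-≉ λ s≈t → t∉image (s , s∈S , s≈t)

    ≈-image-Nbhd : ∀ {x₁ x₂ S} → x₁ ≈ x₂ → Nbhd x₁ S → Nbhd x₂ (≈-image S)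
    ≈-image-Nbhd {x₁} {x₂} {S} x₁≈x₂ S-nbhd x₂∈C∁image =
      Nbhd⇒¬C-of-disjoint S-nbhd (avoiding-disjoint S) x₁⊨𝓝avoiding
      where
      x₂⊨𝓝avoiding : x₂ ⊨ 𝓝 (avoiding S)
      x₂⊨𝓝avoiding = C-mono (avoiding-outside-≈-image S) x₂ x₂∈C∁image

      x₁⊨𝓝avoiding : x₁ ⊨ 𝓝 (avoiding S)
      x₁⊨𝓝avoiding = from (toWitness x₁≈x₂ (𝓝 (avoiding S))) x₂⊨𝓝avoiding

    ≈-isCMBisimulation : IsCMBisimulation M _≈_
    ≈-isCMBisimulation = record
      { nonempty = inhabited , inhabited , ≈-refl
      ; atoms    = λ x₁≈x₂ → let e = toWitness x₁≈x₂ ∘ atom in (to ∘ e) , (from ∘ e)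
      ; zig      = λ x₁≈x₂ S₁ S₁-nbhd → ≈-image S₁ , ≈-image-Nbhd x₁≈x₂ S₁-nbhd , λ _ → id
      ; zag      = λ x₁≈x₂ S₂ S₂-nbhd →
                     ≈-image S₂ , ≈-image-Nbhd (≈-sym x₁≈x₂) S₂-nbhd ,
                     λ { _ (s₂ , s₂∈S₂ , s₂≈s₁) → s₂ , s₂∈S₂ , ≈-sym s₂≈s₁ }
      }

    equivalent⇒bisimilar : ∀ {x₁ x₂} → IML-equivalent M x₁ x₂ → CM-bisimilar M x₁ x₂
    equivalent⇒bisimilar equiv = _≈_ , ≈-isCMBisimulation , fromWitness equiv

corollary1 : (lem : ∀ {ℓ} → ExcludedMiddle ℓ) →
    ∀ {AP : Set} (M : ClosureModel AP) (x₁ x₂ : ClosureModel.X M) →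
    IML-equivalent M x₁ x₂ ⇔ CM-bisimilar M x₁ x₂
corollary1 lem M x₁ x₂ =
  mk⇔ (Classical.equivalent⇒bisimilar lem M) (Classical.bisimilar⇒equivalent lem M)
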